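{- Let $b,c,d$ be positive integers with $d\leq c$ and $d\leq b$. Then (1) there exists an infinite set $A$ with $A\in\mathrm{GC}(b,c,d)$, and (2) there exists an infinite set $B$ with $B\notin\mathrm{GC}(b,c,d)$.
   Context: Sets are languages over $\Sigma=\{0,1\}$; FP is the class of polynomial-time computable functions. For positive integers $b,c,d$, $\mathrm{GC}(b,c,d)$ is the class of sets $L$ for which there is an FP function $f$ such that for every $n\geq1$ and all distinct strings $y_1,\dots,y_n$ (given as a tuple in lexicographic order): $f(y_1,\dots,y_n)\subseteq\{y_1,\dots,y_n\}$, $\|f(y_1,\dots,y_n)\|\leq c$, and if $\|L\cap\{y_1,\dots,y_n\}\|\geq b$ then $\|L\cap f(y_1,\dots,y_n)\|\geq d$. -}

module Defs where

open import Data.Nat using (ℕ; zero; suc; _+_; _^_; _≤_)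
open import Data.Fin using (Fin)
open import Data.Maybe using (Maybe; just; nothing)
open import Data.Bool using (Bool; true; false)
open import Data.List using (List; []; _∷_; _++_; [_]; length; concatMap; deduplicate)
open import Data.List.Properties using (≡-dec)
open import Data.List.Relation.Unary.All using (All)
open import Data.List.Relation.Unary.Linked using (Linked)
open import Data.List.Relation.Unary.Unique.Propositional using (Unique)
open import Data.List.Membership.Propositional using (_∈_)
open import Data.Product using (Σ; ∃; _×_; _,_)
open import Relation.Binary.PropositionalEquality using (_≡_)
open import Relation.Nullary using (¬_)
import Data.Bool as B

Word : Set
Word = List Bool

Language : Set₁
Language = Word → Set

Finite : Language → Set
Finite L = Σ (List Word) λ xs → ∀ w → L w → w ∈ xs

Infinite : Language → Set
Infinite L = ¬ Finite L

-- strict lexicographic order on words (0 < 1, proper prefix is smaller)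
data _<ˡ_ : Word → Word → Set where
  []<∷  : ∀ {x xs} → [] <ˡ (x ∷ xs)
  0<1   : ∀ {xs ys} → (false ∷ xs) <ˡ (true ∷ ys)
  same  : ∀ {x xs ys} → xs <ˡ ys → (x ∷ xs) <ˡ (x ∷ ys)

-- Deterministic one-tape Turing machines (two-way infinite tape)

data In : Set where
  i0 i1 isep : In

data Sym : Set where
  ⌜_⌝   : In → Sym
  blank : Sym

data Move : Set where
  left right stay : Move

record TM : Set where
  field
    nQ    : ℕ
    start : Fin nQ
    -- nothing = halt
    δ     : Fin nQ → Sym → Maybe (Fin nQ × Sym × Move)

record Config (M : TM) : Set where
  constructor cfg
  field
    state : Fin (TM.nQ M)
    lft   : List Sym   -- cells left of head, nearest first
    hd    : Sym
    rgt   : List Sym   -- cells right of head, nearest first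

moveHead : Move → List Sym → Sym → List Sym → List Sym × Sym × List Sym
moveHead left  []      h r       = [] , blank , h ∷ r
moveHead left  (x ∷ l) h r       = l , x , h ∷ r
moveHead right l       h []      = h ∷ l , blank , []
moveHead right l       h (x ∷ r) = h ∷ l , x , r
moveHead stay  l       h r       = l , h , r

mkCfg : (M : TM) → Fin (TM.nQ M) → List Sym × Sym × List Sym → Config M
mkCfg M q (l , h , r) = cfg q l h r

stepWith : (M : TM) → Config M → Maybe (Fin (TM.nQ M) × Sym × Move) → Maybe (Config M)
stepWith M c nothing = nothing
stepWith M (cfg _ l _ r) (just (q′ , s , m)) = just (mkCfg M q′ (moveHead m l s r))

step : (M : TM) → Config M → Maybe (Config M)
step M c = stepWith M c (TM.δ M (Config.state c) (Config.hd c))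

Halted : (M : TM) → Config M → Set
Halted M c = step M c ≡ nothing

runWith : (M : TM) → ℕ → Config M → Maybe (Config M) → Config M
run : (M : TM) → ℕ → Config M → Config M
runWith M t c nothing   = c
runWith M t c (just c′) = run M t c′
run M zero    c = c
run M (suc t) c = runWith M t c (step M c)

initCfg : (M : TM) → List In → Config M
initCfg M []       = cfg (TM.start M) [] blank []
initCfg M (x ∷ xs) = cfg (TM.start M) [] ⌜ x ⌝ (Data.List.map ⌜_⌝ xs)

-- output: the non-blank symbols from the head position rightwards
readOut : List Sym → List In
readOut []          = []
readOut (blank ∷ _) = []
readOut (⌜ x ⌝ ∷ r) = x ∷ readOut r

output : (M : TM) → Config M → List In
output M c = readOut (Config.hd c ∷ Config.rgt c)

ComputesIn : TM → ℕ → (List In → List In) → Set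
ComputesIn M k f = ∀ x →
  Halted M (run M (length x ^ k + k) (initCfg M x))
  × output M (run M (length x ^ k + k) (initCfg M x)) ≡ f x

FP : (List In → List In) → Set
FP f = Σ TM λ M → Σ ℕ λ k → ComputesIn M k f

encWord : Word → List In
encWord []          = []
encWord (false ∷ w) = i0 ∷ encWord w
encWord (true ∷ w)  = i1 ∷ encWord w

encTuple : List Word → List In
encTuple = concatMap (λ y → encWord y ++ [ isep ])

-- ‖L ∩ xs‖ ≥ m : there are m distinct members of xs lying in L
AtLeast : Language → ℕ → List Word → Set
AtLeast L m xs = Σ (List Word) λ ws →
  Unique ws × length ws ≡ m × All (_∈ xs) ws × All L ws

card : List Word → ℕ
card zs = length (deduplicate (≡-dec B._≟_) zs)

GC : ℕ → ℕ → ℕ → Language → Set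
GC b c d L = Σ (List In → List In) λ f → FP f ×
  (∀ (ys : List Word) → 1 ≤ length ys → Linked _<ˡ_ ys →
     Σ (List Word) λ zs →
       f (encTuple ys) ≡ encTuple zs
       × All (_∈ ys) zs
       × card zs ≤ c
       × (AtLeast L b ys → AtLeast L d zs))

{-# OPTIONS --safe #-}
module Submission where

-- Σ* is in GC(b, c, d): a polynomial-time machine returns the first d words of the input
-- tuple; the tuple lists distinct words, so it has d of them whenever it has b ≥ d.
--
-- A set B outside GC(b, c, d) is built by diagonalisation. Every machine M with time exponent k
-- owns a block of b + c words, all beginning with a code of (M, k), and B takes from that block
-- the first b words that M, run for |x|^k + k steps on the block, does not output. If M computed a
-- GC(b, c, d) selector, its at most c answers on the block would have to include a word of B, but
-- B meets the block only in words M avoids. Codes grow with k, so B is infinite.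

open import Defs
open import Data.Bool using (Bool; true; false)
import Data.Bool as Bool
open import Data.Empty using (⊥-elim)
open import Data.Fin using (Fin; toℕ; fromℕ; inject₁)
import Data.Fin as Fin
open import Data.Fin.Properties using (toℕ-fromℕ; toℕ-inject₁; toℕ-injective)
open import Data.List using (List; []; _∷_; _++_; [_]; _ʳ++_; length; map; take; drop; filter; replicate; applyUpTo; allFin; cartesianProduct)
open import Data.List.Extrema.Nat using (argmax; f[xs]≤f[argmax])
open import Data.List.Membership.Propositional using (_∈_; _∉_)
open import Data.List.Membership.Propositional.Properties using (∈-filter⁻; ∈-deduplicate⁺; ∈-map⁻; ∈-allFin; ∈-cartesianProduct⁺)
open import Data.List.Properties using (≡-dec; ∷-injectiveʳ; ++-assoc; map-cong; length-map; length-applyUpTo; length-removeAt′; length-take; length-replicate; length-deduplicate; filter-all)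
open import Data.List.Membership.DecPropositional (≡-dec Bool._≟_) using (_∈?_; _∉?_)
import Data.List.Relation.Binary.Sublist.Propositional as Sublist
open import Data.List.Relation.Binary.Sublist.Propositional.Properties using (take-⊆)
open import Data.List.Relation.Unary.All as All using (All; []; _∷_)
open import Data.List.Relation.Unary.AllPairs as AllPairs using ([]; _∷_)
open import Data.List.Relation.Unary.Any using (here; there; _─_)
open import Data.List.Relation.Unary.Linked as Linked using (Linked)
open import Data.List.Relation.Unary.Linked.Properties using (Linked⇒AllPairs; applyUpTo⁺₂; map⁺)
open import Data.List.Relation.Unary.Unique.Propositional using (Unique)
import Data.List.Relation.Unary.Unique.Propositional.Properties as Unique
open import Data.Maybe using (Maybe; just; nothing)
open import Data.Nat using (ℕ; zero; suc; _+_; _*_; _^_; _∸_; _⊓_; _≤_; _<_; z≤n; s≤s)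
open import Data.Nat.Properties
open import Data.Nat.Tactic.RingSolver using (solve-∀)
open import Data.Product using (Σ; ∃; _×_; _,_; proj₁; proj₂; map₂; uncurry)
open import Data.Unit using (⊤; tt)
open import Function using (_∘_)
open import Relation.Binary.PropositionalEquality using (_≡_; _≢_; refl; sym; trans; cong; cong₂; subst; module ≡-Reasoning)
open import Relation.Nullary using (¬_; Dec; yes; no; ¬?)

-- Sorted tuples and counting

<ˡ-trans : ∀ {u v w} → u <ˡ v → v <ˡ w → u <ˡ w
<ˡ-trans []<∷     0<1      = []<∷
<ˡ-trans []<∷     (same _) = []<∷
<ˡ-trans 0<1      (same _) = 0<1
<ˡ-trans (same _) 0<1      = 0<1
<ˡ-trans (same p) (same q) = same (<ˡ-trans p q)

<ˡ-irrefl : ∀ {w} → ¬ w <ˡ w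
<ˡ-irrefl (same p) = <ˡ-irrefl p

<ˡ⇒≢ : ∀ {u v} → u <ˡ v → u ≢ v
<ˡ⇒≢ u<u refl = <ˡ-irrefl u<u

Linked-<ˡ⇒Unique : ∀ {ws} → Linked _<ˡ_ ws → Unique ws
Linked-<ˡ⇒Unique = AllPairs.map <ˡ⇒≢ ∘ Linked⇒AllPairs <ˡ-trans

unbounded⇒Infinite : (L : Language) → (∀ n → ∃ λ w → L w × n < length w) → Infinite L
unbounded⇒Infinite L unbounded (ws , covers)
  with w , w∈L , longer ← unbounded (length (argmax length [] ws))
  = <⇒≱ longer (All.lookup (f[xs]≤f[argmax] [] ws) (covers w w∈L))

module _ {A : Set} where

  ∈-─ : ∀ {u v : A} {vs} (p : v ∈ vs) → u ∈ vs → v ≢ u → u ∈ (vs ─ p)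
  ∈-─ (here refl) (here refl) v≢u = ⊥-elim (v≢u refl)
  ∈-─ (here _)    (there q)   _   = q
  ∈-─ (there _)   (here refl) _   = here refl
  ∈-─ (there p)   (there q)   v≢u = there (∈-─ p q v≢u)

  Unique⊆⇒length≤ : ∀ {us vs : List A} → Unique us → All (_∈ vs) us → length us ≤ length vs
  Unique⊆⇒length≤ []               []       = z≤n
  Unique⊆⇒length≤ {u ∷ us} {vs} (u≢us ∷ us!) (u∈vs ∷ us⊆vs) = begin
    suc (length us)           ≤⟨ s≤s (Unique⊆⇒length≤ us! us⊆vs─u) ⟩
    suc (length (vs ─ u∈vs))  ≡⟨ length-removeAt′ vs _ ⟨
    length vs                 ∎
    where
    open ≤-Reasoning
    us⊆vs─u : All (_∈ (vs ─ u∈vs)) us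
    us⊆vs─u = All.zipWith (λ (w∈vs , u≢w) → ∈-─ u∈vs w∈vs u≢w) (us⊆vs , u≢us)

length-filter-∁+filter : ∀ {A : Set} {P : A → Set} (P? : ∀ x → Dec (P x)) xs →
  length xs ≡ length (filter (¬? ∘ P?) xs) + length (filter P? xs)
length-filter-∁+filter P? [] = refl
length-filter-∁+filter P? (x ∷ xs) with P? x
... | yes _ = trans (cong suc (length-filter-∁+filter P? xs)) (sym (+-suc _ _))
... | no  _ = cong suc (length-filter-∁+filter P? xs)

Unique⇒length≤∉+card : ∀ {ys} zs → Unique ys → length ys ≤ length (filter (_∉? zs) ys) + card zs
Unique⇒length≤∉+card {ys} zs ys! = begin
  length ys                                                       ≡⟨ length-filter-∁+filter (_∈? zs) ys ⟩
  length (filter (_∉? zs) ys) + length (filter (_∈? zs) ys)      ≤⟨ +-monoʳ-≤ _ members≤card ⟩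
  length (filter (_∉? zs) ys) + card zs                           ∎
  where
  open ≤-Reasoning
  members≤card : length (filter (_∈? zs) ys) ≤ card zs
  members≤card = Unique⊆⇒length≤ (Unique.filter⁺ (_∈? zs) ys!)
    (All.tabulate (∈-deduplicate⁺ _ ∘ proj₂ ∘ ∈-filter⁻ (_∈? zs) {xs = ys}))

-- Running machines

record Reaches (M : TM) (c : Config M) (n : ℕ) (c′ : Config M) : Set where
  constructor reaches
  field run-+ : ∀ t → run M (n + t) c ≡ run M t c′

Within : (M : TM) → ℕ → Config M → Config M → Set
Within M T c c′ = ∃ λ n → n ≤ T × Reaches M c n c′

module _ {M : TM} where

  step⇒Reaches : ∀ {c c′} → step M c ≡ just c′ → Reaches M c 1 c′
  step⇒Reaches {c} c→c′ = reaches λ t → cong (runWith M t c) c→c′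

  Reaches-trans : ∀ {c c′ c″ m n} → Reaches M c m c′ → Reaches M c′ n c″ → Reaches M c (m + n) c″
  Reaches-trans {c} {m = m} {n} (reaches r) (reaches r′) =
    reaches λ t → trans (cong (λ s → run M s c) (+-assoc m n t)) (trans (r (n + t)) (r′ t))

  Reaches⇒Within : ∀ {c c′ n} → Reaches M c n c′ → Within M n c c′
  Reaches⇒Within r = _ , ≤-refl , r

  Within-step : ∀ {c c′ c″ T} → step M c ≡ just c′ → Within M T c′ c″ → Within M (suc T) c c″
  Within-step c→c′ (n , n≤T , r) = suc n , s≤s n≤T , Reaches-trans (step⇒Reaches c→c′) r

  Within-mono : ∀ {c c′ T T′} → T ≤ T′ → Within M T c c′ → Within M T′ c c′
  Within-mono T≤T′ (n , n≤T , r) = n , ≤-trans n≤T T≤T′ , r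

  run-Halted : ∀ {h} → Halted M h → ∀ t → run M t h ≡ h
  run-Halted h↛ zero    = refl
  run-Halted h↛ (suc t) rewrite h↛ = refl

  Within-Halted⇒run : ∀ {c h T} → Within M T c h → Halted M h → run M T c ≡ h
  Within-Halted⇒run {c} {T = T} (n , n≤T , reaches r) h↛ = begin
    run M T c              ≡⟨ cong (λ s → run M s c) (m+[n∸m]≡n n≤T) ⟨
    run M (n + (T ∸ n)) c  ≡⟨ r (T ∸ n) ⟩
    run M (T ∸ n) _        ≡⟨ run-Halted h↛ (T ∸ n) ⟩
    _                      ∎
    where open ≡-Reasoning

  at : Fin (TM.nQ M) → List Sym → List Sym → Config M
  at q L []      = cfg q L blank []
  at q L (s ∷ X) = cfg q L s X

  atˡ : Fin (TM.nQ M) → List Sym → List Sym → Config M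
  atˡ q []      R = cfg q [] blank R
  atˡ q (s ∷ L) R = cfg q L s R

  mkCfg-right : ∀ q L s X → mkCfg M q (moveHead right L s X) ≡ at q (s ∷ L) X
  mkCfg-right q L s []      = refl
  mkCfg-right q L s (_ ∷ _) = refl

  mkCfg-left : ∀ q L s R → mkCfg M q (moveHead left L s R) ≡ atˡ q L (s ∷ R)
  mkCfg-left q []      s R = refl
  mkCfg-left q (_ ∷ _) s R = refl

  initCfg≡at : ∀ x → initCfg M x ≡ at (TM.start M) [] (map ⌜_⌝ x)
  initCfg≡at []      = refl
  initCfg≡at (_ ∷ _) = refl

  output-at : ∀ q L X → output M (at q L X) ≡ readOut X
  output-at q L []      = refl
  output-at q L (_ ∷ _) = refl

readOut-++-blank : ∀ x junk → readOut (map ⌜_⌝ x ++ blank ∷ junk) ≡ x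
readOut-++-blank []      junk = refl
readOut-++-blank (a ∷ x) junk = cong (a ∷_) (readOut-++-blank x junk)

-- A machine returning the first d words

keep : ℕ → List In → List In
keep zero    _          = []
keep (suc n) []         = []
keep (suc n) (i0 ∷ x)   = i0 ∷ keep (suc n) x
keep (suc n) (i1 ∷ x)   = i1 ∷ keep (suc n) x
keep (suc n) (isep ∷ x) = isep ∷ keep n x

keep-encWord : ∀ n w x → keep (suc n) (encWord w ++ x) ≡ encWord w ++ keep (suc n) x
keep-encWord n []          x = refl
keep-encWord n (false ∷ w) x = cong (i0 ∷_) (keep-encWord n w x)
keep-encWord n (true ∷ w)  x = cong (i1 ∷_) (keep-encWord n w x)

keep-encTuple : ∀ n ys → keep n (encTuple ys) ≡ encTuple (take n ys)
keep-encTuple zero    ys       = refl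
keep-encTuple (suc n) []       = refl
keep-encTuple (suc n) (y ∷ ys) = begin
  keep (suc n) ((encWord y ++ [ isep ]) ++ encTuple ys)  ≡⟨ cong (keep (suc n)) (++-assoc (encWord y) _ _) ⟩
  keep (suc n) (encWord y ++ isep ∷ encTuple ys)         ≡⟨ keep-encWord n y _ ⟩
  encWord y ++ isep ∷ keep n (encTuple ys)               ≡⟨ cong (λ x → encWord y ++ isep ∷ x) (keep-encTuple n ys) ⟩
  encWord y ++ isep ∷ encTuple (take n ys)               ≡⟨ ++-assoc (encWord y) _ _ ⟨
  encTuple (y ∷ take n ys)                               ∎
  where open ≡-Reasoning

module Truncation (d : ℕ) where

  pattern rewinding  = Fin.zero
  pattern halting    = Fin.suc Fin.zero
  pattern scanning i = Fin.suc (Fin.suc i)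

  -- In state scanning i, i more separators may be copied before the head erases a cell.
  δ : Fin (3 + d) → Sym → Maybe (Fin (3 + d) × Sym × Move)
  δ rewinding                blank      = just (halting , blank , right)
  δ rewinding                s          = just (rewinding , s , left)
  δ halting                  _          = nothing
  δ (scanning Fin.zero)      _          = just (rewinding , blank , left)
  δ (scanning (Fin.suc i))   blank      = just (rewinding , blank , left)
  δ (scanning (Fin.suc i))   ⌜ isep ⌝   = just (scanning (inject₁ i) , ⌜ isep ⌝ , right)
  δ (scanning (Fin.suc i))   s          = just (scanning (Fin.suc i) , s , right)

  truncator : TM
  truncator = record { nQ = 3 + d ; start = scanning (fromℕ d) ; δ = δ }

  finished : List Sym → Config truncator
  finished = at halting [ blank ]

  finished-Halted : ∀ X → Halted truncator (finished X)
  finished-Halted []      = refl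
  finished-Halted (_ ∷ _) = refl

  rewind : ∀ l R → Reaches truncator (atˡ rewinding (map ⌜_⌝ l) R) (suc (length l)) (finished (map ⌜_⌝ l ʳ++ R))
  rewind []      R = step⇒Reaches (cong just (mkCfg-right halting [] blank R))
  rewind (a ∷ l) R = Reaches-trans (step⇒Reaches (cong just (mkCfg-left rewinding (map ⌜_⌝ l) ⌜ a ⌝ R))) (rewind l (⌜ a ⌝ ∷ R))

  halt-erasing : ∀ {q} l x →
    step truncator (at q (map ⌜_⌝ l) (map ⌜_⌝ x)) ≡ just (atˡ rewinding (map ⌜_⌝ l) (blank ∷ drop 1 (map ⌜_⌝ x))) →
    Within truncator (2 + length l + 2 * length x)
      (at q (map ⌜_⌝ l) (map ⌜_⌝ x)) (finished (map ⌜_⌝ l ʳ++ blank ∷ drop 1 (map ⌜_⌝ x)))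
  halt-erasing l x erases = Within-mono (m≤m+n (2 + length l) _) (Within-step erases (Reaches⇒Within (rewind l _)))

  copy-one : ∀ {q q′ c} a l x →
    step truncator (at q (map ⌜_⌝ l) (⌜ a ⌝ ∷ map ⌜_⌝ x)) ≡ just (at q′ (map ⌜_⌝ (a ∷ l)) (map ⌜_⌝ x)) →
    Within truncator (2 + length (a ∷ l) + 2 * length x) (at q′ (map ⌜_⌝ (a ∷ l)) (map ⌜_⌝ x)) c →
    Within truncator (2 + length l + 2 * length (a ∷ x)) (at q (map ⌜_⌝ l) (map ⌜_⌝ (a ∷ x))) c
  copy-one a l x moves = Within-mono (≤-reflexive (shift (length l) (length x))) ∘ Within-step moves
    where
    shift : ∀ m n → suc (2 + suc m + 2 * n) ≡ 2 + m + 2 * suc n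
    shift = solve-∀

  scan : ∀ i l x → ∃ λ junk →
    Within truncator (2 + length l + 2 * length x)
      (at (scanning i) (map ⌜_⌝ l) (map ⌜_⌝ x))
      (finished (map ⌜_⌝ l ʳ++ map ⌜_⌝ (keep (toℕ i) x) ++ blank ∷ junk))
  scan Fin.zero    l []         = _ , halt-erasing l [] (cong just (mkCfg-left rewinding _ blank _))
  scan Fin.zero    l (a ∷ x)    = _ , halt-erasing l (a ∷ x) (cong just (mkCfg-left rewinding _ blank _))
  scan (Fin.suc i) l []         = _ , halt-erasing l [] (cong just (mkCfg-left rewinding _ blank _))
  scan (Fin.suc i) l (i0 ∷ x)   =
    map₂ (copy-one i0 l x (cong just (mkCfg-right _ _ _ _))) (scan (Fin.suc i) (i0 ∷ l) x)
  scan (Fin.suc i) l (i1 ∷ x)   =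
    map₂ (copy-one i1 l x (cong just (mkCfg-right _ _ _ _))) (scan (Fin.suc i) (i1 ∷ l) x)
  scan (Fin.suc i) l (isep ∷ x) rewrite sym (toℕ-inject₁ i) =
    map₂ (copy-one isep l x (cong just (mkCfg-right _ _ _ _))) (scan (inject₁ i) (isep ∷ l) x)

  cubic-time : ∀ n → 2 + 0 + 2 * n ≤ n ^ 3 + 3
  cubic-time 0                = s≤s (s≤s z≤n)
  cubic-time 1                = ≤-refl
  cubic-time n@(suc (suc m))  = begin
    2 + 2 * n   ≡⟨ +-comm 2 (2 * n) ⟩
    2 * n + 2   ≤⟨ +-mono-≤ (*-mono-≤ (s≤s (s≤s (z≤n {m}))) (m≤m*n n (n * 1))) (n≤1+n 2) ⟩
    n ^ 3 + 3   ∎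
    where open ≤-Reasoning

  truncator-computes : ComputesIn truncator 3 (keep d)
  truncator-computes x with junk , within ← scan (fromℕ d) [] x =
    subst (Halted truncator) (sym ran) (finished-Halted tape) , (begin
      output truncator (run truncator (length x ^ 3 + 3) (initCfg truncator x))  ≡⟨ cong (output truncator) ran ⟩
      output truncator (finished tape)                                           ≡⟨ output-at halting _ tape ⟩
      readOut tape                                                               ≡⟨ readOut-++-blank _ junk ⟩
      keep (toℕ (fromℕ d)) x                                                     ≡⟨ cong (λ n → keep n x) (toℕ-fromℕ d) ⟩
      keep d x                                                                   ∎)
    where
    open ≡-Reasoning
    tape = map ⌜_⌝ (keep (toℕ (fromℕ d)) x) ++ blank ∷ junk
    ran : run truncator (length x ^ 3 + 3) (initCfg truncator x) ≡ finished tape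
    ran = trans (cong (run truncator (length x ^ 3 + 3)) (initCfg≡at x))
                (Within-Halted⇒run (Within-mono (cubic-time (length x)) within) (finished-Halted tape))

AtLeast⇒≤length : ∀ {L m ys} → AtLeast L m ys → m ≤ length ys
AtLeast⇒≤length (ws , ws! , refl , ws⊆ys , _) = Unique⊆⇒length≤ ws! ws⊆ys

take-⊆-All : ∀ {A : Set} n (xs : List A) → All (_∈ xs) (take n xs)
take-⊆-All n xs = All.tabulate (Sublist.lookup (take-⊆ n xs))

Σ* : Language
Σ* _ = ⊤

Σ*-Infinite : Infinite Σ*
Σ*-Infinite = unbounded⇒Infinite Σ* λ n →
  replicate (suc n) true , tt , ≤-reflexive (sym (cong suc (length-replicate n)))

Σ*-GC : ∀ b c d → d ≤ c → d ≤ b → GC b c d Σ*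
Σ*-GC b c d d≤c d≤b =
  keep d , (Truncation.truncator d , 3 , Truncation.truncator-computes d) , λ ys _ sorted →
  take d ys , keep-encTuple d ys , take-⊆-All d ys , card-take≤c ys ,
  λ b-in-ys → take d ys , Unique.take⁺ d (Linked-<ˡ⇒Unique sorted) ,
    trans (length-take d ys) (m≤n⇒m⊓n≡m (≤-trans d≤b (AtLeast⇒≤length b-in-ys))) ,
    All.tabulate (λ w∈ → w∈) , All.tabulate (λ _ → tt)
  where
  card-take≤c : ∀ ys → card (take d ys) ≤ c
  card-take≤c ys = begin
    card (take d ys)    ≤⟨ length-deduplicate _ (take d ys) ⟩
    length (take d ys)  ≡⟨ length-take d ys ⟩
    d ⊓ length ys       ≤⟨ m⊓n≤m d _ ⟩
    d                   ≤⟨ d≤c ⟩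
    c                   ∎
    where open ≤-Reasoning

-- Coding machines by words

unary : ℕ → Word → Word
unary zero    r = false ∷ r
unary (suc n) r = true ∷ unary n r

unary-injective : ∀ m n {r r′} → unary m r ≡ unary n r′ → m ≡ n × r ≡ r′
unary-injective zero    zero    refl = refl , refl
unary-injective (suc m) (suc n) eq with unary-injective m n (∷-injectiveʳ eq)
... | refl , r≡r′ = refl , r≡r′

unary-monoʳ-<ˡ : ∀ n {r r′} → r <ˡ r′ → unary n r <ˡ unary n r′
unary-monoʳ-<ˡ zero    r<r′ = same r<r′
unary-monoʳ-<ˡ (suc n) r<r′ = same (unary-monoʳ-<ˡ n r<r′)

n<length-unary : ∀ n r → n < length (unary n r)
n<length-unary zero    r = s≤s z≤n
n<length-unary (suc n) r = s≤s (n<length-unary n r)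

symbolIndex : Sym → ℕ
symbolIndex blank    = 0
symbolIndex ⌜ i0 ⌝   = 1
symbolIndex ⌜ i1 ⌝   = 2
symbolIndex ⌜ isep ⌝ = 3

indexSymbol : ℕ → Sym
indexSymbol 0 = blank
indexSymbol 1 = ⌜ i0 ⌝
indexSymbol 2 = ⌜ i1 ⌝
indexSymbol _ = ⌜ isep ⌝

symbolIndex-injective : ∀ {s s′} → symbolIndex s ≡ symbolIndex s′ → s ≡ s′
symbolIndex-injective {s} {s′} eq = trans (sym (retract s)) (trans (cong indexSymbol eq) (retract s′))
  where
  retract : ∀ s → indexSymbol (symbolIndex s) ≡ s
  retract blank    = refl
  retract ⌜ i0 ⌝   = refl
  retract ⌜ i1 ⌝   = refl
  retract ⌜ isep ⌝ = refl

moveIndex : Move → ℕ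
moveIndex left  = 0
moveIndex right = 1
moveIndex stay  = 2

indexMove : ℕ → Move
indexMove 0 = left
indexMove 1 = right
indexMove _ = stay

moveIndex-injective : ∀ {m m′} → moveIndex m ≡ moveIndex m′ → m ≡ m′
moveIndex-injective {m} {m′} eq = trans (sym (retract m)) (trans (cong indexMove eq) (retract m′))
  where
  retract : ∀ m → indexMove (moveIndex m) ≡ m
  retract left  = refl
  retract right = refl
  retract stay  = refl

Entry : ℕ → Set
Entry n = Maybe (Fin n × Sym × Move)

encEntry : ∀ {n} → Entry n → Word → Word
encEntry nothing            r = false ∷ r
encEntry (just (q , s , m)) r = true ∷ unary (toℕ q) (unary (symbolIndex s) (unary (moveIndex m) r))

encEntry-injective : ∀ {n} (e e′ : Entry n) {r r′} → encEntry e r ≡ encEntry e′ r′ → e ≡ e′ × r ≡ r′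
encEntry-injective nothing nothing refl = refl , refl
encEntry-injective (just (q , s , m)) (just (q′ , s′ , m′)) eq
  with q≡ , eq₁ ← unary-injective (toℕ q) (toℕ q′) (∷-injectiveʳ eq)
  with s≡ , eq₂ ← unary-injective (symbolIndex s) (symbolIndex s′) eq₁
  with m≡ , r≡r′ ← unary-injective (moveIndex m) (moveIndex m′) eq₂
  rewrite toℕ-injective q≡ | symbolIndex-injective s≡ | moveIndex-injective m≡
  = refl , r≡r′

encEntry-monoʳ-<ˡ : ∀ {n} (e : Entry n) {r r′} → r <ˡ r′ → encEntry e r <ˡ encEntry e r′
encEntry-monoʳ-<ˡ nothing            r<r′ = same r<r′
encEntry-monoʳ-<ˡ (just (q , s , m)) r<r′ =
  same (unary-monoʳ-<ˡ (toℕ q) (unary-monoʳ-<ˡ (symbolIndex s) (unary-monoʳ-<ˡ (moveIndex m) r<r′)))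

module _ {A : Set} {n : ℕ} where

  encGraph : List A → (A → Entry n) → Word → Word
  encGraph []       g r = r
  encGraph (x ∷ xs) g r = encEntry (g x) (encGraph xs g r)

  encGraph-injective : ∀ xs {g g′ r r′} → encGraph xs g r ≡ encGraph xs g′ r′ →
    All (λ x → g x ≡ g′ x) xs × r ≡ r′
  encGraph-injective []       eq = [] , eq
  encGraph-injective (x ∷ xs) {g} {g′} eq
    with gx≡ , eq₁ ← encEntry-injective (g x) (g′ x) eq
    with g≡ , r≡r′ ← encGraph-injective xs eq₁
    = gx≡ ∷ g≡ , r≡r′

  encGraph-cong : ∀ xs {g g′} → (∀ x → g x ≡ g′ x) → ∀ r → encGraph xs g r ≡ encGraph xs g′ r
  encGraph-cong []       g≗g′ r = refl
  encGraph-cong (x ∷ xs) g≗g′ r = cong₂ encEntry (g≗g′ x) (encGraph-cong xs g≗g′ r)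

  encGraph-monoʳ-<ˡ : ∀ xs g {r r′} → r <ˡ r′ → encGraph xs g r <ˡ encGraph xs g r′
  encGraph-monoʳ-<ˡ []       g r<r′ = r<r′
  encGraph-monoʳ-<ˡ (x ∷ xs) g r<r′ = encEntry-monoʳ-<ˡ (g x) (encGraph-monoʳ-<ˡ xs g r<r′)

symbols : List Sym
symbols = blank ∷ ⌜ i0 ⌝ ∷ ⌜ i1 ⌝ ∷ ⌜ isep ⌝ ∷ []

∈-symbols : ∀ s → s ∈ symbols
∈-symbols blank    = here refl
∈-symbols ⌜ i0 ⌝   = there (here refl)
∈-symbols ⌜ i1 ⌝   = there (there (here refl))
∈-symbols ⌜ isep ⌝ = there (there (there (here refl)))

stateSymbolPairs : ∀ n → List (Fin n × Sym)
stateSymbolPairs n = cartesianProduct (allFin n) symbols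

∈-stateSymbolPairs : ∀ {n} q s → (q , s) ∈ stateSymbolPairs n
∈-stateSymbolPairs q s = ∈-cartesianProduct⁺ (∈-allFin q) (∈-symbols s)

-- k is the exponent of the time bound; r selects a word within the block of (M, k)
code : TM → ℕ → Word → Word
code M k r = unary k (unary (TM.nQ M) (unary (toℕ (TM.start M)) (encGraph (stateSymbolPairs (TM.nQ M)) (uncurry (TM.δ M)) r)))

code-monoʳ-<ˡ : ∀ M k {r r′} → r <ˡ r′ → code M k r <ˡ code M k r′
code-monoʳ-<ˡ M k r<r′ =
  unary-monoʳ-<ˡ k (unary-monoʳ-<ˡ _ (unary-monoʳ-<ˡ _ (encGraph-monoʳ-<ˡ (stateSymbolPairs (TM.nQ M)) _ r<r′)))

-- Codes see the transition table only pointwise, so they identify machines up to this relation.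
data _≈ᵀ_ : TM → TM → Set where
  same-δ : ∀ {n s δ δ′} → (∀ q x → δ q x ≡ δ′ q x) →
    record { nQ = n ; start = s ; δ = δ } ≈ᵀ record { nQ = n ; start = s ; δ = δ′ }

code-injective : ∀ M M′ k k′ {r r′} → code M k r ≡ code M′ k′ r′ → k ≡ k′ × M ≈ᵀ M′
code-injective record { nQ = n ; start = s ; δ = δ } record { nQ = n′ ; start = s′ ; δ = δ′ } k k′ eq
  with refl , eq₁ ← unary-injective k k′ eq
  with refl , eq₂ ← unary-injective n n′ eq₁
  with s≡ , eq₃ ← unary-injective (toℕ s) (toℕ s′) eq₂
  with refl ← toℕ-injective s≡
  = refl , same-δ λ q x → All.lookup (proj₁ (encGraph-injective (stateSymbolPairs n) eq₃)) (∈-stateSymbolPairs q x)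

code-cong : ∀ {M M′} → M ≈ᵀ M′ → ∀ k r → code M k r ≡ code M′ k r
code-cong (same-δ {n} {s} δ≗δ′) k r =
  cong (unary k ∘ unary n ∘ unary (toℕ s)) (encGraph-cong (stateSymbolPairs n) (uncurry δ≗δ′) r)

outputAfter : (M : TM) → ℕ → List In → List In
outputAfter M t x = output M (run M t (initCfg M x))

outputAfter-cong : ∀ {M M′} → M ≈ᵀ M′ → ∀ t x → outputAfter M t x ≡ outputAfter M′ t x
outputAfter-cong (same-δ {n} {s} {δ} {δ′} δ≗δ′) t x = begin
  output M (run M t (initCfg M x))              ≡⟨ output-recast (run M t (initCfg M x)) ⟩
  output M′ (recast (run M t (initCfg M x)))    ≡⟨ cong (output M′) (run-recast t (initCfg M x)) ⟨
  output M′ (run M′ t (recast (initCfg M x)))   ≡⟨ cong (output M′ ∘ run M′ t) (recast-initCfg x) ⟩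
  output M′ (run M′ t (initCfg M′ x))           ∎
  where
  open ≡-Reasoning
  M M′ : TM
  M  = record { nQ = n ; start = s ; δ = δ }
  M′ = record { nQ = n ; start = s ; δ = δ′ }

  recast : Config M → Config M′
  recast (cfg q L h R) = cfg q L h R

  output-recast : ∀ c → output M c ≡ output M′ (recast c)
  output-recast (cfg _ _ _ _) = refl

  recast-initCfg : ∀ x → recast (initCfg M x) ≡ initCfg M′ x
  recast-initCfg []      = refl
  recast-initCfg (_ ∷ _) = refl

  recast-mkCfg : ∀ q p → mkCfg M′ q p ≡ recast (mkCfg M q p)
  recast-mkCfg q (L , h , R) = refl

  run-recast : ∀ t c → run M′ t (recast c) ≡ recast (run M t c)
  run-recast zero    c             = refl
  run-recast (suc t) c@(cfg q L h R) =
    trans (cong (λ e → runWith M′ t c′ (stepWith M′ c′ e)) (sym (δ≗δ′ q h))) (continue (δ q h))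
    where
    c′ = recast c
    continue : ∀ e → runWith M′ t c′ (stepWith M′ c′ e) ≡ recast (runWith M t c (stepWith M c e))
    continue nothing               = refl
    continue (just (q′ , s′ , m)) = trans (cong (run M′ t) (recast-mkCfg q′ (moveHead m L s′ R))) (run-recast t _)

-- The diagonal language

pushFront : Bool → List Word → List Word
pushFront a []       = [ [ a ] ]
pushFront a (w ∷ ws) = (a ∷ w) ∷ ws

decodeTuple : List In → List Word
decodeTuple []         = []
decodeTuple (i0 ∷ x)   = pushFront false (decodeTuple x)
decodeTuple (i1 ∷ x)   = pushFront true (decodeTuple x)
decodeTuple (isep ∷ x) = [] ∷ decodeTuple x

decodeTuple-encWord : ∀ w x → decodeTuple (encWord w ++ isep ∷ x) ≡ w ∷ decodeTuple x
decodeTuple-encWord []          x = refl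
decodeTuple-encWord (false ∷ w) x = cong (pushFront false) (decodeTuple-encWord w x)
decodeTuple-encWord (true ∷ w)  x = cong (pushFront true) (decodeTuple-encWord w x)

decodeTuple-encTuple : ∀ ys → decodeTuple (encTuple ys) ≡ ys
decodeTuple-encTuple []       = refl
decodeTuple-encTuple (y ∷ ys) = begin
  decodeTuple ((encWord y ++ [ isep ]) ++ encTuple ys)  ≡⟨ cong decodeTuple (++-assoc (encWord y) _ _) ⟩
  decodeTuple (encWord y ++ isep ∷ encTuple ys)         ≡⟨ decodeTuple-encWord y _ ⟩
  y ∷ decodeTuple (encTuple ys)                         ≡⟨ cong (y ∷_) (decodeTuple-encTuple ys) ⟩
  y ∷ ys                                                ∎
  where open ≡-Reasoning

ladder : ℕ → List Word
ladder = applyUpTo (λ i → replicate i true)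

ladder-sorted : ∀ m → Linked _<ˡ_ (ladder m)
ladder-sorted m = applyUpTo⁺₂ _ m rung<ˡ
  where
  rung<ˡ : ∀ i → replicate i true <ˡ replicate (suc i) true
  rung<ˡ zero    = []<∷
  rung<ˡ (suc i) = same (rung<ˡ i)

head-∈-take : ∀ {A : Set} (g : Word → A) {n m} → 1 ≤ n → 1 ≤ m → g [] ∈ take n (map g (ladder m))
head-∈-take g (s≤s _) (s≤s _) = here refl

eraser : TM
eraser = record { nQ = 1 ; start = Fin.zero ; δ = λ q _ → just (q , blank , stay) }

eraser-idles : ∀ t q L R → run eraser t (cfg q L blank R) ≡ cfg q L blank R
eraser-idles zero    q L R = refl
eraser-idles (suc t) q L R = eraser-idles t q L R

eraser-silent : ∀ {t} → 1 ≤ t → ∀ x → outputAfter eraser t x ≡ []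
eraser-silent {suc t} _ x with initCfg eraser x
... | cfg q L h R rewrite eraser-idles t q L R = refl

1≤n^k+k : ∀ n k → 1 ≤ n ^ k + k
1≤n^k+k n zero    = ≤-refl
1≤n^k+k n (suc k) = ≤-trans (s≤s z≤n) (m≤n+m (suc k) (n ^ suc k))

module Diagonal (b c : ℕ) where

  block : TM → ℕ → List Word
  block M k = map (code M k) (ladder (b + c))

  block-sorted : ∀ M k → Linked _<ˡ_ (block M k)
  block-sorted M k = map⁺ (Linked.map (code-monoʳ-<ˡ M k) (ladder-sorted (b + c)))

  length-block : ∀ M k → length (block M k) ≡ b + c
  length-block M k = trans (length-map (code M k) (ladder (b + c))) (length-applyUpTo _ (b + c))

  block-nonempty : 1 ≤ b → ∀ M k → 1 ≤ length (block M k)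
  block-nonempty 1≤b M k = ≤-trans 1≤b (≤-trans (m≤m+n b c) (≤-reflexive (sym (length-block M k))))

  block-cong : ∀ {M M′} → M ≈ᵀ M′ → ∀ k → block M k ≡ block M′ k
  block-cong M≈M′ k = map-cong (code-cong M≈M′ k) _

  response : TM → ℕ → List Word → List Word
  response M k ys = decodeTuple (outputAfter M (length (encTuple ys) ^ k + k) (encTuple ys))

  response-cong : ∀ {M M′} → M ≈ᵀ M′ → ∀ k ys → response M k ys ≡ response M′ k ys
  response-cong M≈M′ k ys = cong decodeTuple (outputAfter-cong M≈M′ (length (encTuple ys) ^ k + k) (encTuple ys))

  avoiders : List Word → List Word → List Word
  avoiders zs ys = take b (filter (_∉? zs) ys)

  chosen : TM → ℕ → List Word
  chosen M k = avoiders (response M k (block M k)) (block M k)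

  diagonal : Language
  diagonal w = Σ TM λ M → Σ ℕ λ k → w ∈ chosen M k

  chosen-cong : ∀ {M M′} → M ≈ᵀ M′ → ∀ k → chosen M k ≡ chosen M′ k
  chosen-cong {M} {M′} M≈M′ k = cong₂ avoiders
    (trans (response-cong M≈M′ k (block M k)) (cong (response M′ k) (block-cong M≈M′ k)))
    (block-cong M≈M′ k)

  ∈-chosen⁻ : ∀ {M k w} → w ∈ chosen M k → w ∈ block M k × w ∉ response M k (block M k)
  ∈-chosen⁻ {M} {k} = ∈-filter⁻ (_∉? response M k (block M k)) ∘ Sublist.lookup (take-⊆ b _)

  -- codes are injective up to ≈ᵀ, so overlapping blocks belong to equivalent machines
  chosen-overlap : ∀ {M M′ k k′ w} → w ∈ block M k → w ∈ block M′ k′ → chosen M k ≡ chosen M′ k′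
  chosen-overlap {M} {M′} {k} {k′} w∈ w∈′
    with r , _ , refl ← ∈-map⁻ (code M k) w∈
    with r′ , _ , eq ← ∈-map⁻ (code M′ k′) w∈′
    with refl , M≈M′ ← code-injective M M′ k k′ eq
    = chosen-cong M≈M′ k

  b≤length-filter-∉ : ∀ M k → card (response M k (block M k)) ≤ c →
    b ≤ length (filter (_∉? response M k (block M k)) (block M k))
  b≤length-filter-∉ M k card≤c = +-cancelʳ-≤ c b _ (begin
    b + c                                          ≡⟨ length-block M k ⟨
    length (block M k)                             ≤⟨ Unique⇒length≤∉+card zs (Linked-<ˡ⇒Unique (block-sorted M k)) ⟩
    length (filter (_∉? zs) (block M k)) + card zs ≤⟨ +-monoʳ-≤ _ card≤c ⟩
    length (filter (_∉? zs) (block M k)) + c       ∎)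
    where
    open ≤-Reasoning
    zs = response M k (block M k)

  chosen-AtLeast : ∀ M k → card (response M k (block M k)) ≤ c → AtLeast diagonal b (block M k)
  chosen-AtLeast M k card≤c =
    chosen M k ,
    Unique.take⁺ b (Unique.filter⁺ _ (Linked-<ˡ⇒Unique (block-sorted M k))) ,
    trans (length-take b _) (m≤n⇒m⊓n≡m (b≤length-filter-∉ M k card≤c)) ,
    All.tabulate (proj₁ ∘ ∈-chosen⁻) ,
    All.tabulate (λ w∈ → M , k , w∈)

  diagonal-not-GC : ∀ d → 1 ≤ b → 1 ≤ d → ¬ GC b c d diagonal
  diagonal-not-GC d 1≤b 1≤d (f , (M , k , computes) , selects)
    with zs , f≡zs , zs⊆block , card≤c , preserves ← selects (block M k) (block-nonempty 1≤b M k) (block-sorted M k)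
    = escape (preserves (chosen-AtLeast M k (subst (λ ws → card ws ≤ c) (sym response≡zs) card≤c)))
    where
    response≡zs : response M k (block M k) ≡ zs
    response≡zs = trans (cong decodeTuple (trans (proj₂ (computes _)) f≡zs)) (decodeTuple-encTuple zs)

    -- a chosen word of zs lies in block M k, so it was chosen from this very block, which avoids zs
    escape : ¬ AtLeast diagonal d zs
    escape ([] , _ , 0≡d , _) = <⇒≢ 1≤d 0≡d
    escape (w ∷ _ , _ , _ , w∈zs ∷ _ , (M′ , k′ , w∈chosen′) ∷ _) =
      proj₂ (∈-chosen⁻ (subst (w ∈_) (sym same-choice) w∈chosen′)) (subst (w ∈_) (sym response≡zs) w∈zs)
      where
      same-choice : chosen M k ≡ chosen M′ k′
      same-choice = chosen-overlap (All.lookup zs⊆block w∈zs) (proj₁ (∈-chosen⁻ w∈chosen′))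

  diagonal-Infinite : 1 ≤ b → Infinite diagonal
  diagonal-Infinite 1≤b = unbounded⇒Infinite diagonal λ k →
    code eraser k [] , (eraser , k , subst (code eraser k [] ∈_) (sym (chosen-eraser k)) first∈) , n<length-unary k _
    where
    first∈ : ∀ {k} → code eraser k [] ∈ take b (block eraser k)
    first∈ {k} = head-∈-take (code eraser k) 1≤b (≤-trans 1≤b (m≤m+n b c))

    chosen-eraser : ∀ k → chosen eraser k ≡ take b (block eraser k)
    chosen-eraser k = begin
      chosen eraser k                     ≡⟨ cong (λ zs → avoiders zs (block eraser k)) silent ⟩
      avoiders [] (block eraser k)        ≡⟨ cong (take b) (filter-all (_∉? []) (All.tabulate λ _ ())) ⟩
      take b (block eraser k)             ∎
      where
      open ≡-Reasoning
      silent : response eraser k (block eraser k) ≡ []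
      silent = cong decodeTuple (eraser-silent (1≤n^k+k _ k) _)

lemma4p10 : (b c d : ℕ) → 1 ≤ b → 1 ≤ c → 1 ≤ d → d ≤ c → d ≤ b →
    (Σ Language λ A → Infinite A × GC b c d A)
    × (Σ Language λ B → Infinite B × ¬ GC b c d B)
lemma4p10 b c d 1≤b _ 1≤d d≤c d≤b =
  (Σ* , Σ*-Infinite , Σ*-GC b c d d≤c d≤b) ,
  (diagonal , diagonal-Infinite 1≤b , diagonal-not-GC d 1≤b 1≤d)
  where open Diagonal b c
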